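{- Let $r\ge1$, regard $a_1,\dots,a_r$ as indeterminates, and let $f(x)=(x+a_1)\cdots(x+a_r)$. For all $j,n\in\mathbb{N}$ and all $\beta_1,\dots,\beta_r\in\mathbb{N}$, the coefficient of $a_1^{\beta_1}\cdots a_r^{\beta_r}$ in the polynomial $H_{j,n}^f=h_{n-j}(f(1),f(2),\dots,f(j))$ equals the number of $r$-Stirling partitions of order $(n,j)$ whose $0$-subset contains exactly $\beta_i+1$ elements with index $i$, for every $i\in\{1,\dots,r\}$.
   Context: $h_m(x_1,\dots,x_j)$ is the complete homogeneous symmetric polynomial of degree $m$ (with $h_0=1$ and $h_m=0$ for $m<0$; $h_m()=0$ for $m\ge1$). Let $Y_n=\{m_i:0\le m\le n,\ 1\le i\le r\}$ ($r$ labeled copies of $0,1,\dots,n$; $m_i$ is said to have index $i$). An $r$-Stirling partition of order $(n,j)$ is a set partition of $Y_n$ into $j+1$ nonempty subsets such that each subset contains all copies $m_1,\dots,m_r$ of the smallest number $m$ occurring in it, and, if $n\neq0$, no subset contains both $0_i$ and $1_i$ for any $i$. The $0$-subset is the subset containing $0_1,\dots,0_r$. -}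

module Defs where

open import Data.Nat using (ℕ; zero; suc; _+_; _∸_; _≤_; _<_; _≤ᵇ_)
open import Data.Fin using (Fin; toℕ) renaming (zero to fzero; suc to fsuc; _≟_ to _≟ᶠ_)
open import Data.Vec using (Vec; replicate; zipWith; tabulate; lookup)
open import Data.Vec.Properties using (≡-dec)
open import Data.List using (List; []; _∷_; _++_; concatMap; map; length; filter; foldr; upTo; allFin)
open import Data.List.Relation.Unary.Unique.Propositional using (Unique)
open import Data.List.Membership.Propositional using (_∈_)
open import Data.Product using (Σ; ∃; _×_; _,_)
open import Data.Sum using (_⊎_)
open import Data.Bool using (if_then_else_)
open import Function.Bundles using (_⇔_)
open import Relation.Binary.PropositionalEquality using (_≡_; _≢_)
import Data.Nat as ℕ

-- A monomial a₁^{e₁}⋯a_r^{e_r} is its exponent vector (Vec ℕ r);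
-- a polynomial is a finite multiset of monomials (a list, each entry
-- contributing coefficient 1).

Mono : ℕ → Set
Mono r = Vec ℕ r

Poly : ℕ → Set
Poly r = List (Mono r)

coeff : ∀ {r} → Mono r → Poly r → ℕ
coeff β p = length (filter (λ m → ≡-dec ℕ._≟_ m β) p)

0ₚ : ∀ {r} → Poly r
0ₚ = []

1ₚ : ∀ {r} → Poly r
1ₚ {r} = replicate r 0 ∷ []

_⊕_ : ∀ {r} → Poly r → Poly r → Poly r
p ⊕ q = p ++ q

_⊗_ : ∀ {r} → Poly r → Poly r → Poly r
p ⊗ q = concatMap (λ m → map (zipWith _+_ m) q) p

constₚ : ∀ {r} → ℕ → Poly r
constₚ zero = []
constₚ (suc k) = 1ₚ ⊕ constₚ k

var : ∀ {r} → Fin r → Poly r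
var i = tabulate (λ i' → if ⌊ i ≟ᶠ i' ⌋' then 1 else 0) ∷ []
  where
  open import Relation.Nullary.Decidable using () renaming (⌊_⌋ to ⌊_⌋')

fpoly : (r : ℕ) → ℕ → Poly r
fpoly r k = foldr _⊗_ 1ₚ (map (λ i → constₚ k ⊕ var i) (allFin r))

hₚ : ∀ {r} → ℕ → List (Poly r) → Poly r
hₚ zero [] = 1ₚ
hₚ (suc m) [] = 0ₚ
hₚ zero (x ∷ xs) = 1ₚ
hₚ (suc m) (x ∷ xs) = hₚ (suc m) xs ⊕ (x ⊗ hₚ m (x ∷ xs))

-- H^f_{j,n} = h_{n-j}(f(1),…,f(j))   (= 0 when n < j, as h_m = 0 for m < 0)
H : (r j n : ℕ) → Poly r
H r j n = if j ≤ᵇ n then hₚ (n ∸ j) (map (λ k → fpoly r (suc k)) (upTo j)) else 0ₚ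

-- Set partitions of Y_n = {m_i : 0 ≤ m ≤ n, 1 ≤ i ≤ r} into j+1 blocks.
-- Y_n is indexed by (m , i) : Fin (suc n) × Fin r (i is 0-based here,
-- representing index i+1).  A set partition into j+1 nonempty blocks is
-- represented canonically (no quotient) by a labelling
--   L : Vec (Vec (Fin (suc j)) r) (suc n),  label of m_i = lab L m i,
-- which is surjective and in restricted-growth form w.r.t. the
-- lexicographic order on (m , i): blocks are numbered in order of their
-- first (least) element.  Two elements are in the same block iff they
-- have the same label.  This is a bijection with set partitions.

Labelling : (r n j : ℕ) → Set
Labelling r n j = Vec (Vec (Fin (suc j)) r) (suc n)

lab : ∀ {r n j} → Labelling r n j → Fin (suc n) → Fin r → Fin (suc j)
lab L m i = lookup (lookup L m) i

_≺_ : ∀ {r n} → (Fin (suc n) × Fin r) → (Fin (suc n) × Fin r) → Set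
(m , i) ≺ (m' , i') = (toℕ m < toℕ m') ⊎ ((m ≡ m') × (toℕ i < toℕ i'))

record IsSetPartition {r n j : ℕ} (L : Labelling r n j) : Set where
  field
    nonempty  : ∀ (b : Fin (suc j)) → ∃ λ m → ∃ λ i → lab L m i ≡ b
    canonical : ∀ m i c → toℕ (lab L m i) ≡ suc c →
                ∃ λ m' → ∃ λ i' → ((m' , i') ≺ (m , i)) × (toℕ (lab L m' i') ≡ c)

record IsRStirling {r n j : ℕ} (L : Labelling r n j) : Set where
  field
    partition : IsSetPartition L
    minCopies : ∀ m i → (∀ m' i' → lab L m' i' ≡ lab L m i → toℕ m ≤ toℕ m') →
                ∀ i' → lab L m i' ≡ lab L m i
    sep01     : ∀ (m : Fin (suc n)) → toℕ m ≡ 1 → ∀ i → lab L fzero i ≢ lab L m i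

-- number of elements of index i in the block containing 0_i
-- (for r-Stirling partitions this block is the 0-subset)
zeroBlockCount : ∀ {r n j} → Labelling r n j → Fin r → ℕ
zeroBlockCount {n = n} L i = length (filter (λ m → lab L m i ≟ᶠ lab L fzero i) (allFin (suc n)))

ZeroProfile : ∀ {r n j} → Labelling r n j → Vec ℕ r → Set
ZeroProfile L β = ∀ i → zeroBlockCount L i ≡ suc (lookup β i)

HasCard : {A : Set} → (A → Set) → ℕ → Set
HasCard {A} P N = Σ (List A) λ xs → Unique xs × (∀ x → (x ∈ xs) ⇔ P x) × (length xs ≡ N)

-- Read a labelling row by row, row m holding the labels of m₁, …, m_r.  In an
-- r-Stirling partition every row either opens the next block in all r copies
-- or only uses blocks already open, and rows 0 and 1 open blocks 0 and 1.
-- Below row 0, give label 0 in column i the weight aᵢ and every other label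
-- the weight 1.  The non-opening rows read while blocks 0, …, b are open then
-- sum to (b + a₁)⋯(b + a_r) = f(b), and splitting off the first remaining row
-- (it opens a block or it does not) gives exactly the recursion
-- h_m(x, xs) = h_m(xs) + x · h_{m-1}(x, xs).  So the weights of the partitions,
-- listed by an explicit duplicate-free enumeration, form the polynomial H.

module Submission where

open import Data.Bool using (true; false; if_then_else_)
open import Data.Empty using (⊥-elim)
open import Data.Fin using (Fin; toℕ; fromℕ<) renaming (zero to fzero; suc to fsuc; _≟_ to _≟ᶠ_)
import Data.Fin.Properties as FP
open import Data.List as List
  using (List; []; _∷_; _++_; concatMap; map; length; filter; foldr; allFin; applyUpTo; cartesianProductWith)
import Data.List.Properties as LP
open import Data.List.Membership.Propositional using (_∈_)
import Data.List.Membership.Propositional.Properties as MP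
import Data.List.Relation.Unary.All as All
import Data.List.Relation.Unary.AllPairs as AllPairs
open import Data.List.Relation.Unary.Any using (here; there)
open import Data.List.Relation.Unary.Unique.Propositional using (Unique)
import Data.List.Relation.Unary.Unique.Propositional.Properties as UP
open import Data.Nat as ℕ using (ℕ; zero; suc; _+_; _∸_; _≤_; _<_; z≤n; s≤s; _<?_; _≤?_; _≤ᵇ_)
open import Data.Nat.Properties
open import Data.Product using (_×_; _,_; proj₂; ∃; ∃₂)
open import Data.Sum using (_⊎_; inj₁; inj₂)
open import Data.Unit using (tt)
open import Data.Vec as Vec using (Vec; []; _∷_; replicate; zipWith; tabulate; lookup)
import Data.Vec.Properties as VP
open import Function using (_∘_; id)
open import Function.Bundles using (_⇔_; mk⇔; Equivalence)
open import Relation.Binary.PropositionalEquality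
open import Relation.Nullary using (Dec; yes; no; ¬_; contradiction)
open import Relation.Nullary.Decidable using (⌊_⌋)
open import Relation.Unary using (Decidable)

open import Defs

lookup-extensional : ∀ {A : Set} {n} (xs ys : Vec A n) →
  (∀ i → lookup xs i ≡ lookup ys i) → xs ≡ ys
lookup-extensional xs ys eq = begin
  xs                   ≡⟨ VP.tabulate∘lookup xs ⟨
  tabulate (lookup xs) ≡⟨ VP.tabulate-cong eq ⟩
  tabulate (lookup ys) ≡⟨ VP.tabulate∘lookup ys ⟩
  ys                   ∎
  where open ≡-Reasoning

tabulate-const : ∀ {A : Set} n (x : A) → tabulate {n = n} (λ _ → x) ≡ replicate n x
tabulate-const zero x = refl
tabulate-const (suc n) x = cong (x ∷_) (tabulate-const n x)

length-filter-map : ∀ {A B : Set} {P : A → Set} {Q : B → Set}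
  (P? : Decidable P) (Q? : Decidable Q) (g : B → A) (xs : List B) →
  (∀ {x} → x ∈ xs → P (g x) ⇔ Q x) →
  length (filter P? (map g xs)) ≡ length (filter Q? xs)
length-filter-map P? Q? g [] P⇔Q = refl
length-filter-map P? Q? g (x ∷ xs) P⇔Q with P? (g x) | Q? x
... | yes _  | yes _  = cong suc (length-filter-map P? Q? g xs (P⇔Q ∘ there))
... | yes p  | no ¬q  = contradiction (Equivalence.to (P⇔Q (here refl)) p) ¬q
... | no ¬p  | yes q  = contradiction (Equivalence.from (P⇔Q (here refl)) q) ¬p
... | no _   | no _   = length-filter-map P? Q? g xs (P⇔Q ∘ there)

map-const : ∀ {A B : Set} (y : B) (xs : List A) →
  map (λ _ → y) xs ≡ List.replicate (length xs) y
map-const y [] = refl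
map-const y (x ∷ xs) = cong (y ∷_) (map-const y xs)

applyUpTo-cong : ∀ {A : Set} {f g : ℕ → A} → (∀ k → f k ≡ g k) → ∀ d →
  applyUpTo f d ≡ applyUpTo g d
applyUpTo-cong f≗g zero = refl
applyUpTo-cong f≗g (suc d) = cong₂ _∷_ (f≗g 0) (applyUpTo-cong (f≗g ∘ suc) d)

allFin-suc : ∀ n → allFin (suc n) ≡ fzero ∷ map fsuc (allFin n)
allFin-suc n = cong (fzero ∷_) (sym (LP.map-tabulate id fsuc))

length-filter-<-allFin : ∀ {n b} → b ≤ n → length (filter (λ y → toℕ y <? b) (allFin n)) ≡ b
length-filter-<-allFin {zero} z≤n = refl
length-filter-<-allFin {suc n} {zero} _ = cong length (nothing-below-0 (allFin (suc n)))
  where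
  nothing-below-0 : ∀ {n} (xs : List (Fin n)) → filter (λ y → toℕ y <? 0) xs ≡ []
  nothing-below-0 [] = refl
  nothing-below-0 (x ∷ xs) = nothing-below-0 xs
length-filter-<-allFin {suc n} {suc b} (s≤s b≤n) = begin
  length (filter (λ y → toℕ y <? suc b) (allFin (suc n)))
    ≡⟨ cong (length ∘ filter (λ y → toℕ y <? suc b)) (allFin-suc n) ⟩
  suc (length (filter (λ y → toℕ y <? suc b) (map fsuc (allFin n))))
    ≡⟨ cong suc (length-filter-map (λ y → toℕ y <? suc b) (λ y → toℕ y <? b) fsuc (allFin n)
         (λ _ → mk⇔ ≤-pred s≤s)) ⟩
  suc (length (filter (λ y → toℕ y <? b) (allFin n)))
    ≡⟨ cong suc (length-filter-<-allFin b≤n) ⟩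
  suc b ∎
  where open ≡-Reasoning

<⇒≡suc : ∀ {b t} → b < t → ∃ λ c → t ≡ suc c × b ≤ c
<⇒≡suc (s≤s b≤c) = _ , refl , b≤c

-- Polynomials

liftₚ : ∀ {r} → Poly r → Poly (suc r)
liftₚ = map (0 ∷_)

liftₚ-⊗ : ∀ {r} (p q : Poly r) → liftₚ (p ⊗ q) ≡ liftₚ p ⊗ liftₚ q
liftₚ-⊗ [] q = refl
liftₚ-⊗ (m ∷ p) q = trans (LP.map-++ (0 ∷_) (map (zipWith _+_ m) q) (p ⊗ q))
  (cong₂ _++_ (trans (sym (LP.map-∘ q)) (LP.map-∘ q)) (liftₚ-⊗ p q))

liftₚ-product : ∀ {r} (ps : List (Poly r)) →
  foldr _⊗_ 1ₚ (map liftₚ ps) ≡ liftₚ (foldr _⊗_ 1ₚ ps)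
liftₚ-product [] = refl
liftₚ-product (p ∷ ps) =
  trans (cong (liftₚ p ⊗_) (liftₚ-product ps)) (sym (liftₚ-⊗ p (foldr _⊗_ 1ₚ ps)))

constₚ-lift : ∀ {r} k → constₚ {suc r} k ≡ liftₚ (constₚ {r} k)
constₚ-lift zero = refl
constₚ-lift (suc k) = cong (_ ∷_) (constₚ-lift k)

var-suc : ∀ {r} (i : Fin r) → var (fsuc i) ≡ liftₚ (var i)
var-suc i = cong (λ v → (0 ∷ v) ∷ []) (VP.tabulate-cong (same-indicator i))
  where
  same-indicator : ∀ {r} (i : Fin r) i' →
    (if ⌊ fsuc i ≟ᶠ fsuc i' ⌋ then 1 else 0) ≡ (if ⌊ i ≟ᶠ i' ⌋ then 1 else 0)
  same-indicator i i' with i ≟ᶠ i'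
  ... | yes _ = refl
  ... | no _  = refl

fpoly-factor : ∀ r k → fpoly (suc r) k ≡ (constₚ k ⊕ var fzero) ⊗ liftₚ (fpoly r k)
fpoly-factor r k = begin
  foldr _⊗_ 1ₚ (map factor (allFin (suc r)))
    ≡⟨ cong (foldr _⊗_ 1ₚ ∘ map factor) (allFin-suc r) ⟩
  factor fzero ⊗ foldr _⊗_ 1ₚ (map factor (map fsuc (allFin r)))
    ≡⟨ cong (λ ps → factor fzero ⊗ foldr _⊗_ 1ₚ ps) factors-lift ⟩
  factor fzero ⊗ foldr _⊗_ 1ₚ (map liftₚ (map factor (allFin r)))
    ≡⟨ cong (factor fzero ⊗_) (liftₚ-product (map factor (allFin r))) ⟩
  factor fzero ⊗ liftₚ (fpoly r k) ∎
  where
  open ≡-Reasoning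
  factor : ∀ {r} → Fin r → Poly r
  factor i = constₚ k ⊕ var i
  factor-suc : ∀ i → factor (fsuc i) ≡ liftₚ (factor i)
  factor-suc i = trans (cong₂ _⊕_ (constₚ-lift k) (var-suc i))
                       (sym (LP.map-++ (0 ∷_) (constₚ k) (var i)))
  factors-lift : map factor (map fsuc (allFin r)) ≡ map liftₚ (map factor (allFin r))
  factors-lift = trans (sym (LP.map-∘ (allFin r)))
    (trans (LP.map-cong factor-suc (allFin r)) (LP.map-∘ (allFin r)))

consₚ : ∀ {r} → List ℕ → Poly r → Poly (suc r)
consₚ es p = concatMap (λ e → map (e ∷_) p) es

constₚ-var-zero : ∀ {r} k →
  constₚ {suc r} k ⊕ var fzero ≡ map (_∷ replicate r 0) (List.replicate k 0 ++ 1 ∷ [])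
constₚ-var-zero {r} zero = cong (λ v → (1 ∷ v) ∷ []) (tabulate-const r 0)
constₚ-var-zero (suc k) = cong (_ ∷_) (constₚ-var-zero k)

fpoly-suc : ∀ r k → fpoly (suc r) k ≡ consₚ (List.replicate k 0 ++ 1 ∷ []) (fpoly r k)
fpoly-suc r k = begin
  fpoly (suc r) k                                  ≡⟨ fpoly-factor r k ⟩
  (constₚ k ⊕ var fzero) ⊗ liftₚ F                 ≡⟨ cong (_⊗ liftₚ F) (constₚ-var-zero k) ⟩
  map (_∷ replicate r 0) es ⊗ liftₚ F              ≡⟨ LP.concatMap-map _ (_∷ replicate r 0) es ⟩
  concatMap (λ e → map (zipWith _+_ (e ∷ replicate r 0)) (liftₚ F)) es
                                                   ≡⟨ LP.concatMap-cong prefix es ⟩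
  consₚ es F                                       ∎
  where
  open ≡-Reasoning
  F : Poly r
  F = fpoly r k
  es : List ℕ
  es = List.replicate k 0 ++ 1 ∷ []
  prefix : ∀ e → map (zipWith _+_ (e ∷ replicate r 0)) (liftₚ F) ≡ map (e ∷_) F
  prefix e = trans (sym (LP.map-∘ F))
    (LP.map-cong (λ v → cong₂ _∷_ (+-identityʳ e) (VP.zipWith-identityˡ +-identityˡ v)) F)

⊗-zeroʳ : ∀ {r} (p : Poly r) → p ⊗ 0ₚ ≡ 0ₚ
⊗-zeroʳ [] = refl
⊗-zeroʳ (_ ∷ p) = ⊗-zeroʳ p

fpolys : (r b d : ℕ) → List (Poly r)
fpolys r b zero = []
fpolys r b (suc d) = fpoly r b ∷ fpolys r (suc b) d

applyUpTo-fpolys : ∀ r b d → applyUpTo (λ k → fpoly r (b + k)) d ≡ fpolys r b d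
applyUpTo-fpolys r b zero = refl
applyUpTo-fpolys r b (suc d) = cong₂ _∷_ (cong (fpoly r) (+-identityʳ b))
  (trans (applyUpTo-cong (λ k → cong (fpoly r) (+-suc b k)) d) (applyUpTo-fpolys r (suc b) d))

H≡hₚ : ∀ r {j n} → j ≤ n → H r j n ≡ hₚ (n ∸ j) (fpolys r 1 j)
H≡hₚ r {j} {n} j≤n with j ≤ᵇ n | ≤⇒≤ᵇ j≤n
... | true | _ = cong (hₚ (n ∸ j))
  (trans (LP.map-applyUpTo id (λ k → fpoly r (suc k)) j) (applyUpTo-fpolys r 1 j))

H≡0ₚ : ∀ r {j n} → n < j → H r j n ≡ 0ₚ
H≡0ₚ r {j} {n} n<j with j ≤ᵇ n | ≤ᵇ⇒≤ j n
... | false | _   = refl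
... | true  | j≤n = contradiction (j≤n tt) (<⇒≱ n<j)

-- Labellings as row sequences

-- The order _≺_ of Defs, on Fin len for every len (including 0).
_≺′_ : ∀ {r len} → (Fin len × Fin r) → (Fin len × Fin r) → Set
(m , i) ≺′ (m' , i') = (toℕ m < toℕ m') ⊎ ((m ≡ m') × (toℕ i < toℕ i'))

≺′-suc : ∀ {r len} {k k' : Fin len} {i i' : Fin r} →
  (k' , i') ≺′ (k , i) → (fsuc k' , i') ≺′ (fsuc k , i)
≺′-suc (inj₁ k'<k) = inj₁ (s≤s k'<k)
≺′-suc (inj₂ (refl , i'<i)) = inj₂ (refl , i'<i)

≺′-pred : ∀ {r len} {k k' : Fin len} {i i' : Fin r} →
  (fsuc k' , i') ≺′ (fsuc k , i) → (k' , i') ≺′ (k , i)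
≺′-pred (inj₁ (s≤s k'<k)) = inj₁ k'<k
≺′-pred (inj₂ (refl , i'<i)) = inj₂ (refl , i'<i)

StirlingCount : (r j n : ℕ) → Mono r → Set
StirlingCount r j n β =
  HasCard {Labelling r n j} (λ L → IsRStirling L × ZeroProfile L β) (coeff β (H r j n))

module Rows (r j : ℕ) (i₀ : Fin r) where

  Row : Set
  Row = Vec (Fin (suc j)) r

  label : ∀ {len} → Vec Row len → Fin len → Fin r → Fin (suc j)
  label rows k i = lookup (lookup rows k) i

  Opens : ℕ → Row → Set
  Opens b row = ∀ i → toℕ (lookup row i) ≡ b

  Below : ∀ {r'} → ℕ → Vec (Fin (suc j)) r' → Set
  Below b row = ∀ i → toℕ (lookup row i) < b

  data Admissible : ∀ {len} → ℕ → Vec Row len → Set where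
    done    : Admissible (suc j) []
    opening : ∀ {len b row} {rows : Vec Row len} →
              Opens b row → Admissible (suc b) rows → Admissible b (row ∷ rows)
    staying : ∀ {len b row} {rows : Vec Row len} →
              Below b row → Admissible b rows → Admissible b (row ∷ rows)

  -- The conditions of IsRStirling, imposed only on the labels ≥ b.
  MinCopiesFrom CanonicalFrom CoversFrom : ∀ {len} → ℕ → Vec Row len → Set
  MinCopiesFrom b rows = ∀ k i → b ≤ toℕ (label rows k i) →
    (∀ k' i' → label rows k' i' ≡ label rows k i → toℕ k ≤ toℕ k') →
    ∀ i' → label rows k i' ≡ label rows k i
  CanonicalFrom b rows = ∀ k i c → toℕ (label rows k i) ≡ suc c → b ≤ c →
    ∃₂ λ k' i' → ((k' , i') ≺′ (k , i)) × toℕ (label rows k' i') ≡ c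
  CoversFrom b rows = ∀ t → b ≤ t → t ≤ j → ∃₂ λ k i → toℕ (label rows k i) ≡ t

  record StirlingFrom {len} (b : ℕ) (rows : Vec Row len) : Set where
    field
      minCopies : MinCopiesFrom b rows
      canonical : CanonicalFrom b rows
      covers    : CoversFrom b rows

  admissible-≤ : ∀ {len b} {rows : Vec Row len} → Admissible b rows → b ≤ suc j
  admissible-≤ done = ≤-refl
  admissible-≤ (opening _ adm) = ≤-trans (n≤1+n _) (admissible-≤ adm)
  admissible-≤ (staying _ adm) = admissible-≤ adm

  admissible-covers : ∀ {len b} {rows : Vec Row len} → Admissible b rows → CoversFrom b rows
  admissible-covers done _ b≤t t≤j = contradiction (≤-trans b≤t t≤j) 1+n≰n
  admissible-covers (opening opens adm) t b≤t t≤j with m≤n⇒m<n∨m≡n b≤t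
  ... | inj₂ refl = fzero , i₀ , opens i₀
  ... | inj₁ b<t with admissible-covers adm t b<t t≤j
  ...   | k , i , e = fsuc k , i , e
  admissible-covers (staying _ adm) t b≤t t≤j with admissible-covers adm t b≤t t≤j
  ... | k , i , e = fsuc k , i , e

  admissible-canonical : ∀ {len b} {rows : Vec Row len} → Admissible b rows → CanonicalFrom b rows
  admissible-canonical (opening opens _) fzero i c e b≤c =
    contradiction (subst (_≤ _) (trans (sym (opens i)) e) b≤c) 1+n≰n
  admissible-canonical (staying below _) fzero i c e b≤c =
    contradiction (subst (_< _) e (below i)) (≤⇒≯ (≤-trans b≤c (n≤1+n _)))
  admissible-canonical (opening opens adm) (fsuc k) i c e b≤c with m≤n⇒m<n∨m≡n b≤c
  ... | inj₂ refl = fzero , i₀ , inj₁ (s≤s z≤n) , opens i₀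
  ... | inj₁ b<c with admissible-canonical adm k i c e b<c
  ...   | k' , i' , prec , e' = fsuc k' , i' , ≺′-suc prec , e'
  admissible-canonical (staying _ adm) (fsuc k) i c e b≤c with admissible-canonical adm k i c e b≤c
  ... | k' , i' , prec , e' = fsuc k' , i' , ≺′-suc prec , e'

  admissible-minCopies : ∀ {len b} {rows : Vec Row len} → Admissible b rows → MinCopiesFrom b rows
  admissible-minCopies (opening opens _) fzero i _ _ i' =
    FP.toℕ-injective (trans (opens i') (sym (opens i)))
  admissible-minCopies (staying below _) fzero i b≤ _ _ = contradiction (below i) (≤⇒≯ b≤)
  admissible-minCopies (opening opens adm) (fsuc k) i b≤ minimal with m≤n⇒m<n∨m≡n b≤
  ... | inj₁ b< = admissible-minCopies adm k i b< (λ k' i' e → ≤-pred (minimal (fsuc k') i' e))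
  ... | inj₂ b≡ with minimal fzero i₀ (FP.toℕ-injective (trans (opens i₀) b≡))
  ...   | ()
  admissible-minCopies (staying _ adm) (fsuc k) i b≤ minimal =
    admissible-minCopies adm k i b≤ (λ k' i' e → ≤-pred (minimal (fsuc k') i' e))

  stirlingFrom-tail : ∀ {len b b' row} {rows : Vec Row len} → b ≤ b' → Below b' row →
    StirlingFrom b (row ∷ rows) → StirlingFrom b' rows
  stirlingFrom-tail {b' = b'} {row} {rows} b≤b' below st = record
    { minCopies = minCopies′ ; canonical = canonical′ ; covers = covers′ }
    where
    open StirlingFrom st
    minCopies′ : MinCopiesFrom b' rows
    minCopies′ k i b'≤ minimal = minCopies (fsuc k) i (≤-trans b≤b' b'≤) minimal′
      where
      minimal′ : ∀ k' i' → label (row ∷ rows) k' i' ≡ label rows k i → suc (toℕ k) ≤ toℕ k'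
      minimal′ fzero i' e = contradiction (subst (b' ≤_) (cong toℕ (sym e)) b'≤) (<⇒≱ (below i'))
      minimal′ (fsuc k') i' e = s≤s (minimal k' i' e)
    canonical′ : CanonicalFrom b' rows
    canonical′ k i c e b'≤c with canonical (fsuc k) i c e (≤-trans b≤b' b'≤c)
    ... | fzero , i' , _ , e' = contradiction (subst (_< b') e' (below i')) (≤⇒≯ b'≤c)
    ... | fsuc k' , i' , prec , e' = k' , i' , ≺′-pred prec , e'
    covers′ : CoversFrom b' rows
    covers′ t b'≤t t≤j with covers t (≤-trans b≤b' b'≤t) t≤j
    ... | fzero , i , e = contradiction (subst (_< b') e (below i)) (≤⇒≯ b'≤t)
    ... | fsuc k , i , e = k , i , e

  -- A first-row label c+1 ≥ b+1 would need an earlier element labelled c,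
  -- i.e. another entry of the same (constant) row.
  first-row-opens : ∀ {len b row} {rows : Vec Row len} → StirlingFrom b (row ∷ rows) →
    ∀ i → b ≤ toℕ (lookup row i) → Opens b row
  first-row-opens {b = b} {row} st i b≤ i' = trans (cong toℕ (constant i')) label≡b
    where
    open StirlingFrom st
    constant : ∀ i' → lookup row i' ≡ lookup row i
    constant = minCopies fzero i b≤ (λ _ _ _ → z≤n)
    label≡b : toℕ (lookup row i) ≡ b
    label≡b with m≤n⇒m<n∨m≡n b≤
    ... | inj₂ b≡ = sym b≡
    ... | inj₁ b< with <⇒≡suc b<
    ...   | c , t≡ , b≤c with canonical fzero i c t≡ b≤c
    ...     | fzero , i' , _ , e' =
      contradiction (trans (sym e') (trans (cong toℕ (constant i')) t≡)) (<⇒≢ (n<1+n c))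
    ...     | fsuc _ , _ , inj₁ () , _
    ...     | fsuc _ , _ , inj₂ (() , _) , _

  stirlingFrom⇒admissible : ∀ {len b} (rows : Vec Row len) → b ≤ suc j →
    StirlingFrom b rows → Admissible b rows
  stirlingFrom⇒admissible {b = b} [] b≤ st with b ≤? j
  ... | yes b≤j with StirlingFrom.covers st b ≤-refl b≤j
  ...   | () , _
  stirlingFrom⇒admissible [] b≤ st | no b≰j =
    subst (λ c → Admissible c []) (sym (≤-antisym b≤ (≰⇒> b≰j))) done
  stirlingFrom⇒admissible {b = b} (row ∷ rows) b≤ st with FP.any? (λ i → b ≤? toℕ (lookup row i))
  ... | yes (i , b≤t) = opening opens
      (stirlingFrom⇒admissible rows (subst (_< suc j) (opens i) (FP.toℕ<n (lookup row i)))
        (stirlingFrom-tail (n≤1+n b) (λ i' → ≤-reflexive (cong suc (opens i'))) st))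
    where
    opens : Opens b row
    opens = first-row-opens st i b≤t
  ... | no none = staying below (stirlingFrom⇒admissible rows b≤ (stirlingFrom-tail ≤-refl below st))
    where
    below : Below b row
    below i = ≰⇒> (λ b≤t → none (i , b≤t))

  rstirling⇒admissible : ∀ {n} (L : Labelling r n j) → IsRStirling L → Admissible 0 L
  rstirling⇒admissible L st = stirlingFrom⇒admissible L z≤n record
    { minCopies = λ k i _ → minCopies k i
    ; canonical = λ k i c e _ → canonical k i c e
    ; covers    = λ t _ t≤j → covers t≤j
    }
    where
    open IsRStirling st
    open IsSetPartition partition
    covers : ∀ {t} → t ≤ j → ∃₂ λ k i → toℕ (label L k i) ≡ t
    covers t≤j with nonempty (fromℕ< (s≤s t≤j))
    ... | k , i , e = k , i , trans (cong toℕ e) (FP.toℕ-fromℕ< (s≤s t≤j))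

  admissible⇒rstirling : ∀ {n} (L : Labelling r n j) → Admissible 0 L →
    (∀ (m : Fin (suc n)) → toℕ m ≡ 1 → ∀ i → lab L fzero i ≢ lab L m i) → IsRStirling L
  admissible⇒rstirling L adm separated = record
    { partition = record
      { nonempty  = nonempty
      ; canonical = λ m i c e → admissible-canonical adm m i c e z≤n
      }
    ; minCopies = λ m i → admissible-minCopies adm m i z≤n
    ; sep01     = separated
    }
    where
    nonempty : ∀ b → ∃₂ λ m i → lab L m i ≡ b
    nonempty b with admissible-covers adm (toℕ b) z≤n (≤-pred (FP.toℕ<n b))
    ... | m , i , e = m , i , FP.toℕ-injective e

  -- Enumeration

  -- Labels 1, …, b precede 0, as the terms of constₚ b ⊕ var i in fpoly.
  labelsBelow : ℕ → List (Fin (suc j))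
  labelsBelow zero = []
  labelsBelow (suc b) = map fsuc (filter (λ y → toℕ y <? b) (allFin j)) ++ fzero ∷ []

  ∈-labelsBelow⁻ : ∀ b {x} → x ∈ labelsBelow b → toℕ x < b
  ∈-labelsBelow⁻ (suc b) x∈ with MP.∈-++⁻ (map fsuc (filter (λ y → toℕ y <? b) (allFin j))) x∈
  ... | inj₂ (here refl) = s≤s z≤n
  ... | inj₁ x∈ₛ with MP.∈-map⁻ fsuc x∈ₛ
  ...   | y , y∈ , refl = s≤s (proj₂ (MP.∈-filter⁻ (λ y → toℕ y <? b) {xs = allFin j} y∈))

  ∈-labelsBelow⁺ : ∀ b (x : Fin (suc j)) → toℕ x < b → x ∈ labelsBelow b
  ∈-labelsBelow⁺ (suc b) fzero _ =
    MP.∈-++⁺ʳ (map fsuc (filter (λ y → toℕ y <? b) (allFin j))) (here refl)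
  ∈-labelsBelow⁺ (suc b) (fsuc y) (s≤s y<b) =
    MP.∈-++⁺ˡ (MP.∈-map⁺ fsuc (MP.∈-filter⁺ (λ y → toℕ y <? b) (MP.∈-allFin y) y<b))

  labelsBelow-unique : ∀ b → Unique (labelsBelow b)
  labelsBelow-unique zero = AllPairs.[]
  labelsBelow-unique (suc b) =
    UP.++⁺ (UP.map⁺ FP.suc-injective (UP.filter⁺ (λ y → toℕ y <? b) (UP.allFin⁺ j)))
           (All.[] AllPairs.∷ AllPairs.[]) nonzero∌zero
    where
    nonzero∌zero : ∀ {x} → ¬ (x ∈ map fsuc (filter (λ y → toℕ y <? b) (allFin j)) × x ∈ fzero ∷ [])
    nonzero∌zero (x∈ , here refl) with MP.∈-map⁻ fsuc x∈
    ... | _ , _ , ()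

  rowsBelow : ℕ → (r' : ℕ) → List (Vec (Fin (suc j)) r')
  rowsBelow b zero = [] ∷ []
  rowsBelow b (suc r') = cartesianProductWith _∷_ (labelsBelow b) (rowsBelow b r')

  ∈-rowsBelow⁻ : ∀ {b} r' {row : Vec (Fin (suc j)) r'} → row ∈ rowsBelow b r' → Below b row
  ∈-rowsBelow⁻ {b} (suc r') row∈ i with MP.∈-cartesianProductWith⁻ _∷_ (labelsBelow b) (rowsBelow b r') row∈
  ∈-rowsBelow⁻ {b} (suc r') row∈ fzero    | _ , _ , x∈ , _ , refl = ∈-labelsBelow⁻ b x∈
  ∈-rowsBelow⁻ {b} (suc r') row∈ (fsuc i) | _ , _ , _ , xs∈ , refl = ∈-rowsBelow⁻ r' xs∈ i

  ∈-rowsBelow⁺ : ∀ {b r'} (row : Vec (Fin (suc j)) r') → Below b row → row ∈ rowsBelow b r'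
  ∈-rowsBelow⁺ [] _ = here refl
  ∈-rowsBelow⁺ {b} (x ∷ row) below = MP.∈-cartesianProductWith⁺ _∷_
    (∈-labelsBelow⁺ b x (below fzero)) (∈-rowsBelow⁺ row (below ∘ fsuc))

  rowsBelow-unique : ∀ b r' → Unique (rowsBelow b r')
  rowsBelow-unique b zero = All.[] AllPairs.∷ AllPairs.[]
  rowsBelow-unique b (suc r') =
    UP.cartesianProductWith⁺ _∷_ VP.∷-injective (labelsBelow-unique b) (rowsBelow-unique b r')

  openRow : ∀ {b} → b < suc j → Row
  openRow b<sj = replicate r (fromℕ< b<sj)

  openRow-opens : ∀ {b} (b<sj : b < suc j) → Opens b (openRow b<sj)
  openRow-opens b<sj i = trans (cong toℕ (VP.lookup-replicate i _)) (FP.toℕ-fromℕ< b<sj)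

  openRow-unique : ∀ {b row} (b<sj : b < suc j) → Opens b row → openRow b<sj ≡ row
  openRow-unique b<sj opens =
    lookup-extensional _ _ λ i → FP.toℕ-injective (trans (openRow-opens b<sj i) (sym (opens i)))

  ending : ∀ {b} → Dec (b ≡ suc j) → List (Vec Row 0)
  ending (yes _) = [] ∷ []
  ending (no _)  = []

  openings : ∀ {b len} → Dec (b < suc j) → List (Vec Row len) → List (Vec Row (suc len))
  openings (yes b<sj) E = map (openRow b<sj ∷_) E
  openings (no _)     E = []

  admissibles : (len b : ℕ) → List (Vec Row len)
  admissibles zero      b = ending (b ℕ.≟ suc j)
  admissibles (suc len) b = openings (b <? suc j) (admissibles len (suc b))
                         ++ cartesianProductWith _∷_ (rowsBelow b r) (admissibles len b)

  ∈-openings⁻ : ∀ {b len row} {rows : Vec Row len} {E} (d : Dec (b < suc j)) →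
    row ∷ rows ∈ openings d E → Opens b row × rows ∈ E
  ∈-openings⁻ (yes b<sj) row∈ with MP.∈-map⁻ (openRow b<sj ∷_) row∈
  ... | _ , rows∈ , refl = openRow-opens b<sj , rows∈

  ∈-openings⁺ : ∀ {b len row} {rows : Vec Row len} {E} (d : Dec (b < suc j)) →
    b < suc j → Opens b row → rows ∈ E → row ∷ rows ∈ openings d E
  ∈-openings⁺ (yes b<sj) _ opens rows∈ =
    subst (λ row → row ∷ _ ∈ _) (openRow-unique b<sj opens) (MP.∈-map⁺ (openRow b<sj ∷_) rows∈)
  ∈-openings⁺ (no b≮sj) b<sj = contradiction b<sj b≮sj

  admissibles-sound : ∀ len b {rows} → rows ∈ admissibles len b → Admissible b rows
  admissibles-sound zero b {[]} []∈ = ending-sound (b ℕ.≟ suc j) []∈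
    where
    ending-sound : (d : Dec (b ≡ suc j)) → [] ∈ ending d → Admissible b []
    ending-sound (yes refl) _ = done
  admissibles-sound (suc len) b {row ∷ rows} rows∈
    with MP.∈-++⁻ (openings (b <? suc j) (admissibles len (suc b))) rows∈
  ... | inj₁ ∈openings with ∈-openings⁻ (b <? suc j) ∈openings
  ...   | opens , rows∈′ = opening opens (admissibles-sound len (suc b) rows∈′)
  admissibles-sound (suc len) b {row ∷ rows} _ | inj₂ ∈staying
    with MP.∈-cartesianProductWith⁻ _∷_ (rowsBelow b r) (admissibles len b) ∈staying
  ... | _ , _ , row∈ , rows∈′ , refl = staying (∈-rowsBelow⁻ r row∈) (admissibles-sound len b rows∈′)

  admissibles-complete : ∀ {len b} {rows : Vec Row len} → Admissible b rows →
    rows ∈ admissibles len b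
  admissibles-complete done with suc j ℕ.≟ suc j
  ... | yes _  = here refl
  ... | no ≢sj = contradiction refl ≢sj
  admissibles-complete {b = b} (opening opens adm) = MP.∈-++⁺ˡ
    (∈-openings⁺ (b <? suc j) (admissible-≤ adm) opens (admissibles-complete adm))
  admissibles-complete {suc len} {b} (staying below adm) =
    MP.∈-++⁺ʳ (openings (b <? suc j) (admissibles len (suc b)))
      (MP.∈-cartesianProductWith⁺ _∷_ (∈-rowsBelow⁺ _ below) (admissibles-complete adm))

  admissibles-unique : ∀ len b → Unique (admissibles len b)
  admissibles-unique zero b with b ℕ.≟ suc j
  ... | yes _ = All.[] AllPairs.∷ AllPairs.[]
  ... | no _  = AllPairs.[]
  admissibles-unique (suc len) b = UP.++⁺ (openings-unique (b <? suc j))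
    (UP.cartesianProductWith⁺ _∷_ VP.∷-injective (rowsBelow-unique b r) (admissibles-unique len b))
    opening∌staying
    where
    openings-unique : ∀ d → Unique (openings d (admissibles len (suc b)))
    openings-unique (yes _) = UP.map⁺ VP.∷-injectiveʳ (admissibles-unique len (suc b))
    openings-unique (no _)  = AllPairs.[]
    opening∌staying : ∀ {rows} → ¬ (rows ∈ openings (b <? suc j) (admissibles len (suc b))
                              × rows ∈ cartesianProductWith _∷_ (rowsBelow b r) (admissibles len b))
    opening∌staying {_ ∷ _} (∈openings , ∈staying)
      with ∈-openings⁻ (b <? suc j) ∈openings
         | MP.∈-cartesianProductWith⁻ _∷_ (rowsBelow b r) (admissibles len b) ∈staying
    ... | opens , _ | _ , _ , row∈ , _ , refl = <-irrefl (opens i₀) (∈-rowsBelow⁻ r row∈ i₀)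

  -- Weights

  indicator₀ : Fin (suc j) → ℕ
  indicator₀ fzero    = 1
  indicator₀ (fsuc _) = 0

  rowWeight : ∀ {r'} → Vec (Fin (suc j)) r' → Mono r'
  rowWeight = Vec.map indicator₀

  weight : ∀ {len} → Vec Row len → Mono r
  weight []           = replicate r 0
  weight (row ∷ rows) = zipWith _+_ (rowWeight row) (weight rows)

  weight-count : ∀ {len} (rows : Vec Row len) i →
    lookup (weight rows) i ≡ length (filter (λ k → label rows k i ≟ᶠ fzero) (allFin len))
  weight-count [] i = VP.lookup-replicate i 0
  weight-count {suc len} (row ∷ rows) i = begin
    lookup (zipWith _+_ (rowWeight row) (weight rows)) i
      ≡⟨ VP.lookup-zipWith _+_ i (rowWeight row) (weight rows) ⟩
    lookup (rowWeight row) i + lookup (weight rows) i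
      ≡⟨ cong₂ _+_ (VP.lookup-map i indicator₀ row) (weight-count rows i) ⟩
    indicator₀ (lookup row i) + length (filter (λ k → label rows k i ≟ᶠ fzero) (allFin len))
      ≡⟨ cong (indicator₀ (lookup row i) +_)
           (length-filter-map P? (λ k → label rows k i ≟ᶠ fzero) fsuc (allFin len) (λ _ → mk⇔ id id)) ⟨
    indicator₀ (lookup row i) + length (filter P? (map fsuc (allFin len)))
      ≡⟨ count-first ⟩
    length (filter P? (fzero ∷ map fsuc (allFin len)))
      ≡⟨ cong (length ∘ filter P?) (allFin-suc len) ⟨
    length (filter P? (allFin (suc len))) ∎
    where
    open ≡-Reasoning
    P? : (k : Fin (suc len)) → Dec (label (row ∷ rows) k i ≡ fzero)
    P? k = label (row ∷ rows) k i ≟ᶠ fzero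
    count-first : indicator₀ (lookup row i) + length (filter P? (map fsuc (allFin len))) ≡
                  length (filter P? (fzero ∷ map fsuc (allFin len)))
    count-first with lookup row i
    ... | fzero  = refl
    ... | fsuc _ = refl

  map-rowWeight-cartesian : ∀ {r'} (xs : List (Fin (suc j))) (rows : List (Vec (Fin (suc j)) r')) →
    map rowWeight (cartesianProductWith _∷_ xs rows) ≡ consₚ (map indicator₀ xs) (map rowWeight rows)
  map-rowWeight-cartesian [] rows = refl
  map-rowWeight-cartesian (x ∷ xs) rows =
    trans (LP.map-++ rowWeight (map (x ∷_) rows) (cartesianProductWith _∷_ xs rows))
      (cong₂ _++_ (trans (sym (LP.map-∘ rows)) (LP.map-∘ rows)) (map-rowWeight-cartesian xs rows))

  map-indicator₀-labelsBelow : ∀ {b} → b ≤ j →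
    map indicator₀ (labelsBelow (suc b)) ≡ List.replicate b 0 ++ 1 ∷ []
  map-indicator₀-labelsBelow {b} b≤j = begin
    map indicator₀ (map fsuc nonzero ++ fzero ∷ [])      ≡⟨ LP.map-++ indicator₀ (map fsuc nonzero) _ ⟩
    map indicator₀ (map fsuc nonzero) ++ 1 ∷ []          ≡⟨ cong (_++ 1 ∷ []) (LP.map-∘ nonzero) ⟨
    map (λ _ → 0) nonzero ++ 1 ∷ []                      ≡⟨ cong (_++ 1 ∷ []) (map-const 0 nonzero) ⟩
    List.replicate (length nonzero) 0 ++ 1 ∷ []     ≡⟨ cong (λ k → List.replicate k 0 ++ 1 ∷ [])
                                                              (length-filter-<-allFin b≤j) ⟩
    List.replicate b 0 ++ 1 ∷ []                    ∎
    where
    open ≡-Reasoning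
    nonzero : List (Fin j)
    nonzero = filter (λ y → toℕ y <? b) (allFin j)

  weights-rowsBelow : ∀ {b} r' → b ≤ j → map rowWeight (rowsBelow (suc b) r') ≡ fpoly r' b
  weights-rowsBelow zero b≤j = refl
  weights-rowsBelow {b} (suc r') b≤j = begin
    map rowWeight (cartesianProductWith _∷_ (labelsBelow (suc b)) (rowsBelow (suc b) r'))
      ≡⟨ map-rowWeight-cartesian (labelsBelow (suc b)) (rowsBelow (suc b) r') ⟩
    consₚ (map indicator₀ (labelsBelow (suc b))) (map rowWeight (rowsBelow (suc b) r'))
      ≡⟨ cong₂ consₚ (map-indicator₀-labelsBelow b≤j) (weights-rowsBelow r' b≤j) ⟩
    consₚ (List.replicate b 0 ++ 1 ∷ []) (fpoly r' b)
      ≡⟨ fpoly-suc r' b ⟨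
    fpoly (suc r') b ∎
    where open ≡-Reasoning

  map-weight-cartesian : ∀ {len} (xs : List Row) (E : List (Vec Row len)) →
    map weight (cartesianProductWith _∷_ xs E) ≡ map rowWeight xs ⊗ map weight E
  map-weight-cartesian [] E = refl
  map-weight-cartesian (x ∷ xs) E =
    trans (LP.map-++ weight (map (x ∷_) E) (cartesianProductWith _∷_ xs E))
      (cong₂ _++_ (trans (sym (LP.map-∘ E)) (LP.map-∘ E)) (map-weight-cartesian xs E))

  weights-openRow∷ : ∀ {b len} (sb<sj : suc b < suc j) (E : List (Vec Row len)) →
    map weight (map (openRow sb<sj ∷_) E) ≡ map weight E
  weights-openRow∷ sb<sj E = trans (sym (LP.map-∘ E)) (LP.map-cong weight-openRow E)
    where
    weight-openRow : ∀ {len} (rows : Vec Row len) → weight (openRow sb<sj ∷ rows) ≡ weight rows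
    weight-openRow rows = trans
      (cong (λ w → zipWith _+_ w (weight rows)) (VP.map-replicate indicator₀ (fromℕ< sb<sj) r))
      (VP.zipWith-identityˡ +-identityˡ (weight rows))

  weights-openings : ∀ {b len} (d : Dec (suc b < suc j)) (E : List (Vec Row len)) → suc b ≤ j →
    map weight (openings d E) ≡ map weight E
  weights-openings (yes sb<sj) E _ = weights-openRow∷ sb<sj E
  weights-openings (no sb≮sj) E sb≤j = contradiction (s≤s sb≤j) sb≮sj

  openings-rejected : ∀ {b len} (d : Dec (b < suc j)) {E : List (Vec Row len)} → ¬ b < suc j →
    openings d E ≡ []
  openings-rejected (yes b<sj) b≮sj = contradiction b<sj b≮sj
  openings-rejected (no _)     _    = refl

  admissibles-empty : ∀ len {b} → len + b ≤ j → admissibles len b ≡ []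
  admissibles-empty zero {b} b≤j with b ℕ.≟ suc j
  ... | yes refl = contradiction b≤j 1+n≰n
  ... | no _     = refl
  admissibles-empty (suc len) {b} len+b<j = cong₂ _++_
    (trans (cong (openings (b <? suc j)) (admissibles-empty len (subst (_≤ j) (sym (+-suc len b)) len+b<j)))
           (openings-[] (b <? suc j)))
    (trans (cong (cartesianProductWith _∷_ (rowsBelow b r)) (admissibles-empty len (<⇒≤ len+b<j)))
           (LP.cartesianProductWith-zeroʳ _∷_ (rowsBelow b r)))
    where
    openings-[] : ∀ d → openings {b} {len} d [] ≡ []
    openings-[] (yes _) = refl
    openings-[] (no _)  = refl

  shift : ∀ {b d} → b + suc d ≡ j → suc b + d ≡ j
  shift {b} {d} b+d≡j = trans (sym (+-suc b d)) b+d≡j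

  next-opens : ∀ {b d} → b + suc d ≡ j → suc b ≤ j
  next-opens {b} {d} b+d≡j = subst (suc b ≤_) (shift b+d≡j) (m≤m+n (suc b) d)

  map-weight-admissibles-suc : ∀ len b → map weight (admissibles (suc len) b) ≡
    map weight (openings (b <? suc j) (admissibles len (suc b)))
      ⊕ (map rowWeight (rowsBelow b r) ⊗ map weight (admissibles len b))
  map-weight-admissibles-suc len b =
    trans (LP.map-++ weight (openings (b <? suc j) (admissibles len (suc b))) _)
          (cong (map weight (openings (b <? suc j) (admissibles len (suc b))) ⊕_) (map-weight-cartesian (rowsBelow b r) (admissibles len b)))

  -- Sorting by its first row gives the recursion of hₚ: the first row either
  -- opens block b + 1, or lies in blocks 0, …, b and contributes f(b).
  weights-admissibles : ∀ {b} m d → b + d ≡ j →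
    map weight (admissibles (m + d) (suc b)) ≡ hₚ m (fpolys r b (suc d))
  weights-admissibles {b} zero zero b+0≡j with suc b ℕ.≟ suc j
  ... | yes _ = refl
  ... | no ≢ = contradiction (cong suc (trans (sym (+-identityʳ b)) b+0≡j)) ≢
  weights-admissibles {b} zero (suc d) b+d≡j = begin
    map weight (admissibles (suc d) (suc b))
      ≡⟨ map-weight-admissibles-suc d (suc b) ⟩
    map weight (openings (suc b <? suc j) (admissibles d (suc (suc b))))
      ⊕ (map rowWeight (rowsBelow (suc b) r) ⊗ map weight (admissibles d (suc b)))
      ≡⟨ cong₂ _⊕_ (weights-openings (suc b <? suc j) _ (next-opens b+d≡j))
                   (cong (λ E → map rowWeight (rowsBelow (suc b) r) ⊗ map weight E)
                         (admissibles-empty d (≤-reflexive (trans (+-comm d (suc b)) (shift b+d≡j))))) ⟩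
    map weight (admissibles d (suc (suc b))) ⊕ (map rowWeight (rowsBelow (suc b) r) ⊗ [])
      ≡⟨ cong₂ _⊕_ (weights-admissibles zero d (shift b+d≡j)) (⊗-zeroʳ (map rowWeight (rowsBelow (suc b) r))) ⟩
    1ₚ ⊕ [] ∎
    where open ≡-Reasoning
  weights-admissibles {b} (suc m) d b+d≡j = begin
    map weight (admissibles (suc m + d) (suc b))
      ≡⟨ map-weight-admissibles-suc (m + d) (suc b) ⟩
    map weight (openings (suc b <? suc j) (admissibles (m + d) (suc (suc b))))
      ⊕ (map rowWeight (rowsBelow (suc b) r) ⊗ map weight (admissibles (m + d) (suc b)))
      ≡⟨ cong₂ _⊕_ (opened d b+d≡j (suc b <? suc j))
                   (cong₂ _⊗_ (weights-rowsBelow r (subst (b ≤_) b+d≡j (m≤m+n b d)))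
                              (weights-admissibles m d b+d≡j)) ⟩
    hₚ (suc m) (fpolys r (suc b) d) ⊕ (fpoly r b ⊗ hₚ m (fpolys r b (suc d))) ∎
    where
    open ≡-Reasoning
    opened : ∀ {b} d → b + d ≡ j → (dec : Dec (suc b < suc j)) →
      map weight (openings dec (admissibles (m + d) (suc (suc b)))) ≡ hₚ (suc m) (fpolys r (suc b) d)
    opened {b} zero b+0≡j dec =
      cong (map weight) (openings-rejected dec (<-irrefl (trans (sym (+-identityʳ b)) b+0≡j) ∘ ≤-pred))
    opened {b} (suc d) b+d≡j dec = begin
      map weight (openings dec (admissibles (m + suc d) (suc (suc b))))
        ≡⟨ weights-openings dec _ (next-opens b+d≡j) ⟩
      map weight (admissibles (m + suc d) (suc (suc b)))
        ≡⟨ cong (λ len → map weight (admissibles len (suc (suc b)))) (+-suc m d) ⟩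
      map weight (admissibles (suc m + d) (suc (suc b)))
        ≡⟨ weights-admissibles (suc m) d (shift b+d≡j) ⟩
      hₚ (suc m) (fpolys r (suc b) (suc d)) ∎

  zeroRow : Row
  zeroRow = openRow (s≤s z≤n)

  zeroRow-opens : Opens 0 zeroRow
  zeroRow-opens = openRow-opens (s≤s z≤n)

  zeroBlockCount-zeroRow : ∀ {n} (rows : Vec Row n) i →
    zeroBlockCount {r} {n} {j} (zeroRow ∷ rows) i ≡ suc (lookup (weight rows) i)
  zeroBlockCount-zeroRow {n} rows i = begin
    zeroBlockCount (zeroRow ∷ rows) i
      ≡⟨ cong length (LP.filter-≐ P? Q? ((λ e → trans e first≡0) , (λ e → trans e (sym first≡0)))
                                  (allFin (suc n))) ⟩
    length (filter Q? (allFin (suc n)))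
      ≡⟨ weight-count (zeroRow ∷ rows) i ⟨
    lookup (zipWith _+_ (rowWeight zeroRow) (weight rows)) i
      ≡⟨ VP.lookup-zipWith _+_ i (rowWeight zeroRow) (weight rows) ⟩
    lookup (rowWeight zeroRow) i + lookup (weight rows) i
      ≡⟨ cong (_+ lookup (weight rows) i)
              (trans (VP.lookup-map i indicator₀ zeroRow) (cong indicator₀ first≡0)) ⟩
    suc (lookup (weight rows) i) ∎
    where
    open ≡-Reasoning
    first≡0 : lookup zeroRow i ≡ fzero
    first≡0 = VP.lookup-replicate i fzero
    P? : (m : Fin (suc n)) → Dec (label (zeroRow ∷ rows) m i ≡ label (zeroRow ∷ rows) fzero i)
    Q? : (m : Fin (suc n)) → Dec (label (zeroRow ∷ rows) m i ≡ fzero)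
    P? m = label (zeroRow ∷ rows) m i ≟ᶠ label (zeroRow ∷ rows) fzero i
    Q? m = label (zeroRow ∷ rows) m i ≟ᶠ fzero

  zeroProfile⇔weight : ∀ {n} (rows : Vec Row n) β →
    ZeroProfile {r} {n} {j} (zeroRow ∷ rows) β ⇔ weight rows ≡ β
  zeroProfile⇔weight rows β = mk⇔
    (λ profile → lookup-extensional _ _ λ i →
      suc-injective (trans (sym (zeroBlockCount-zeroRow rows i)) (profile i)))
    (λ weight≡β i → trans (zeroBlockCount-zeroRow rows i) (cong (λ w → suc (lookup w i)) weight≡β))

  stirlingCount-from-weights : ∀ {n} (β : Mono r) (E : List (Vec Row n)) → Unique E →
    (∀ L → L ∈ map (zeroRow ∷_) E ⇔ IsRStirling L) → map weight E ≡ H r j n →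
    StirlingCount r j n β
  stirlingCount-from-weights {n} β E unique stirling weights≡H =
    filter profile? (map (zeroRow ∷_) E) ,
    UP.filter⁺ profile? (UP.map⁺ VP.∷-injectiveʳ unique) ,
    members ,
    count
    where
    profile? : (L : Labelling r n j) → Dec (ZeroProfile L β)
    profile? L = FP.all? (λ i → zeroBlockCount L i ℕ.≟ suc (lookup β i))
    weight≟β : (rows : Vec Row n) → Dec (weight rows ≡ β)
    weight≟β rows = VP.≡-dec ℕ._≟_ (weight rows) β
    members : ∀ L → L ∈ filter profile? (map (zeroRow ∷_) E) ⇔ (IsRStirling L × ZeroProfile L β)
    members L = mk⇔
      (λ L∈ → let L∈′ , profile = MP.∈-filter⁻ profile? L∈ in Equivalence.to (stirling L) L∈′ , profile)
      (λ (st , profile) → MP.∈-filter⁺ profile? (Equivalence.from (stirling L) st) profile)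
    count : length (filter profile? (map (zeroRow ∷_) E)) ≡ coeff β (H r j n)
    count = begin
      length (filter profile? (map (zeroRow ∷_) E))
        ≡⟨ length-filter-map profile? weight≟β (zeroRow ∷_) E (λ {rows} _ → zeroProfile⇔weight rows β) ⟩
      length (filter weight≟β E)
        ≡⟨ length-filter-map (λ m → VP.≡-dec ℕ._≟_ m β) weight≟β weight E (λ _ → mk⇔ id id) ⟨
      coeff β (map weight E)
        ≡⟨ cong (coeff β) weights≡H ⟩
      coeff β (H r j n) ∎
      where open ≡-Reasoning

Fin1-irrelevant : (x y : Fin 1) → x ≡ y
Fin1-irrelevant fzero fzero = refl

module Cases {r} (i₀ : Fin r) (β : Mono r) where

  count-0-0 : StirlingCount r 0 0 β
  count-0-0 = stirlingCount-from-weights β ([] ∷ []) (All.[] AllPairs.∷ AllPairs.[]) stirling refl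
    where
    open Rows r 0 i₀
    only-labelling : (L : Labelling r 0 0) → L ≡ zeroRow ∷ []
    only-labelling (row ∷ []) =
      cong (_∷ []) (lookup-extensional row zeroRow λ i → Fin1-irrelevant (lookup row i) (lookup zeroRow i))
    stirling : ∀ L → L ∈ (zeroRow ∷ []) ∷ [] ⇔ IsRStirling L
    stirling L = mk⇔
      (λ { (here refl) → admissible⇒rstirling (zeroRow ∷ []) (opening zeroRow-opens done) λ { fzero () } })
      (λ _ → here (only-labelling L))

  count-0-suc : ∀ j' → StirlingCount r (suc j') 0 β
  count-0-suc j' = stirlingCount-from-weights β [] AllPairs.[] stirling refl
    where
    open Rows r (suc j') i₀
    no-admissible : ∀ {row} → ¬ Admissible 0 (row ∷ [])
    no-admissible (opening _ ())
    no-admissible (staying below _) with below i₀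
    ... | ()
    stirling : ∀ L → L ∈ [] ⇔ IsRStirling L
    stirling (row ∷ []) = mk⇔ (λ ()) (λ st → contradiction (rstirling⇒admissible _ st) no-admissible)

  count-suc-0 : ∀ n' → StirlingCount r 0 (suc n') β
  count-suc-0 n' = stirlingCount-from-weights β [] AllPairs.[] stirling refl
    where
    open Rows r 0 i₀
    stirling : ∀ L → L ∈ [] ⇔ IsRStirling L
    stirling L = mk⇔ (λ ()) (λ st → ⊥-elim (IsRStirling.sep01 st (fsuc fzero) refl i₀ (Fin1-irrelevant _ _)))

  module _ (n' j' : ℕ) where
    open Rows r (suc j') i₀

    oneRow : Row
    oneRow = openRow (s≤s (s≤s z≤n))

    oneRow-opens : Opens 1 oneRow
    oneRow-opens = openRow-opens (s≤s (s≤s z≤n))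

    Shaped : List (Labelling r (suc n') (suc j'))
    Shaped = map (zeroRow ∷_) (map (oneRow ∷_) (admissibles n' 2))

    shaped⇒rstirling : ∀ L → L ∈ Shaped → IsRStirling L
    shaped⇒rstirling L L∈ with MP.∈-map⁻ (zeroRow ∷_) L∈
    ... | _ , L∈′ , refl with MP.∈-map⁻ (oneRow ∷_) L∈′
    ...   | rest , rest∈ , refl = admissible⇒rstirling _
      (opening zeroRow-opens (opening oneRow-opens (admissibles-sound n' 2 rest∈)))
      separated
      where
      separated : ∀ (m : Fin (suc (suc n'))) → toℕ m ≡ 1 → ∀ i →
        lookup zeroRow i ≢ label (zeroRow ∷ oneRow ∷ rest) m i
      separated (fsuc fzero) _ i e =
        0≢1+n (trans (sym (zeroRow-opens i)) (trans (cong toℕ e) (oneRow-opens i)))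

    -- Row 1 must open block 1: otherwise it lies in block 0 with row 0.
    rstirling⇒shaped : ∀ L → IsRStirling L → L ∈ Shaped
    rstirling⇒shaped (row₀ ∷ row₁ ∷ rest) st with rstirling⇒admissible _ st
    ... | opening opens₀ (opening opens₁ adm) =
      subst₂ (λ row₀ row₁ → row₀ ∷ row₁ ∷ rest ∈ Shaped)
        (openRow-unique (s≤s z≤n) opens₀) (openRow-unique (s≤s (s≤s z≤n)) opens₁)
        (MP.∈-map⁺ (zeroRow ∷_) (MP.∈-map⁺ (oneRow ∷_) (admissibles-complete adm)))
    ... | opening opens₀ (staying below₁ _) =
      ⊥-elim (IsRStirling.sep01 st (fsuc fzero) refl i₀
        (FP.toℕ-injective (trans (opens₀ i₀) (sym (n<1⇒n≡0 (below₁ i₀))))))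
    ... | staying below₀ _ with below₀ i₀
    ...   | ()

    weights≡H : map weight (map (oneRow ∷_) (admissibles n' 2)) ≡ H r (suc j') (suc n')
    weights≡H with j' ≤? n'
    ... | yes j'≤n' = begin
      map weight (map (oneRow ∷_) (admissibles n' 2))
        ≡⟨ weights-openRow∷ (s≤s (s≤s z≤n)) (admissibles n' 2) ⟩
      map weight (admissibles n' 2)
        ≡⟨ cong (λ len → map weight (admissibles len 2)) (m∸n+n≡m j'≤n') ⟨
      map weight (admissibles (n' ∸ j' + j') 2)
        ≡⟨ weights-admissibles (n' ∸ j') j' refl ⟩
      hₚ (n' ∸ j') (fpolys r 1 (suc j'))
        ≡⟨ H≡hₚ r (s≤s j'≤n') ⟨
      H r (suc j') (suc n') ∎
      where open ≡-Reasoning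
    ... | no j'≰n' = begin
      map weight (map (oneRow ∷_) (admissibles n' 2))
        ≡⟨ cong (map weight ∘ map (oneRow ∷_))
                (admissibles-empty n' (≤-trans (≤-reflexive (+-comm n' 2)) (s≤s (≰⇒> j'≰n')))) ⟩
      []
        ≡⟨ H≡0ₚ r (s≤s (≰⇒> j'≰n')) ⟨
      H r (suc j') (suc n') ∎
      where open ≡-Reasoning

    count-suc-suc : StirlingCount r (suc j') (suc n') β
    count-suc-suc = stirlingCount-from-weights β (map (oneRow ∷_) (admissibles n' 2))
      (UP.map⁺ VP.∷-injectiveʳ (admissibles-unique n' 2))
      (λ L → mk⇔ (shaped⇒rstirling L) (rstirling⇒shaped L)) weights≡H

propositionP : (r : ℕ) → 1 ≤ r → (j n : ℕ) → (β : Vec ℕ r) →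
    HasCard {Labelling r n j} (λ L → IsRStirling L × ZeroProfile L β) (coeff β (H r j n))
propositionP (suc r) _ zero    zero    β = Cases.count-0-0 fzero β
propositionP (suc r) _ (suc j) zero    β = Cases.count-0-suc fzero β j
propositionP (suc r) _ zero    (suc n) β = Cases.count-suc-0 fzero β n
propositionP (suc r) _ (suc j) (suc n) β = Cases.count-suc-suc fzero β n j
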